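{- Let $n\ge1$, $0\le q\le 1$, and consider the PASEP on $n$ sites with $\alpha=\beta=1$. For every $\tau\in\{0,1\}^n$, the probability of the configuration $\tau$ under the stationary distribution equals $$\frac{F'''_\tau(q)}{Z_n},$$ where $F'''_\tau(q)$ is the total weight of bicolored Motzkin paths of type $\tau$ and $Z_n=\sum_{\sigma\in\{0,1\}^n}F'''_\sigma(q)$ is the partition function (the total weight of all bicolored Motzkin paths of length $n$).
   Context: PASEP with parameters $\alpha,\beta,q$: the Markov chain on $\{0,1\}^n$ (site $i$ occupied iff $\tau_i=1$) with transition probabilities: if $X=A10B$ and $Y=A01B$ then $P_{X,Y}=\frac1{n+1}$ and $P_{Y,X}=\frac{q}{n+1}$; if $X=0B$, $Y=1B$ then $P_{X,Y}=\frac{\alpha}{n+1}$; if $X=B1$, $Y=B0$ then $P_{X,Y}=\frac{\beta}{n+1}$; all other off-diagonal transitions have probability $0$ and $P_{X,X}=1-\sum_{Y\neq X}P_{X,Y}$. It has a unique stationary distribution. $[m]=1+q+\dots+q^{m-1}$. A bicolored Motzkin path of length $n$ is a sequence $c=(c_1,\dots,c_n)$ with $c_i\in\{N,S,E,\bar E\}$ such that, with $h_i=\#\{j<i:c_j=N\}-\#\{j<i:c_j=S\}$ for $1\le i\le n+1$, one has $h_i\ge0$ for all $i$ and $h_{n+1}=0$. Step $c_i$ ends at height $h_{i+1}$ and has weight $[h_{i+1}+1]$; the weight of the path is the product of its step weights. The path has type $\tau$ if $c_i\in\{N,E\}$ whenever $\tau_i=1$ and $c_i\in\{S,\bar E\}$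 whenever $\tau_i=0$. $F'''_\tau(q)$ is the sum of the weights of all bicolored Motzkin paths of type $\tau$.
   Formalization: The parameter q ranges over the rationals in [0,1], and the stationary distributions, including those in the uniqueness claim, take rational values. -}

module Defs where

open import Data.Bool using (Bool; true; false; _∧_; if_then_else_)
import Data.Bool.Properties as BP
open import Data.Nat as ℕ using (ℕ; zero; suc)
open import Data.Integer using (+_)
open import Data.Rational using (ℚ; 0ℚ; 1ℚ; _+_; _*_; _-_; _÷_; _/_; _≤_; ≢-nonZero)
import Data.Rational.Properties as QP
open import Data.List using (List; []; _∷_; map; foldr; concatMap; filter)
open import Data.Vec using (Vec; []; _∷_)
open import Data.Vec.Properties using (≡-dec)
open import Data.Product using (_×_; _,_; proj₁; proj₂)
open import Relation.Nullary using (yes; no; does)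
open import Relation.Binary.PropositionalEquality using (_≡_)

-- configurations τ ∈ {0,1}^n ; true = occupied (τ_i = 1)
Config : ℕ → Set
Config n = Vec Bool n

allConfigs : (n : ℕ) → List (Config n)
allConfigs zero    = [] ∷ []
allConfigs (suc n) = concatMap (λ v → (false ∷ v) ∷ (true ∷ v) ∷ []) (allConfigs n)

sumL : {A : Set} → (A → ℚ) → List A → ℚ
sumL f = foldr (λ a s → f a + s) 0ℚ

_≟C_ : {n : ℕ} → (X Y : Config n) → _
_≟C_ = ≡-dec BP._≟_

-- total division on ℚ (used only where the denominator is nonzero)
_divQ_ : ℚ → ℚ → ℚ
p divQ r with r Data.Rational.≟ 0ℚ
... | yes _  = 0ℚ
... | no r≢0 = _÷_ p r {{≢-nonZero r≢0}}

private
  pre : {n : ℕ} → Bool → Config n × ℚ → Config (suc n) × ℚ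
  pre b (v , r) = (b ∷ v , r)

bulkMoves : (q : ℚ) → {n : ℕ} → Config n → List (Config n × ℚ)
bulkMoves q []                      = []
bulkMoves q (x ∷ [])                = []
bulkMoves q (true ∷ false ∷ xs)     =
  (false ∷ true ∷ xs , 1ℚ) ∷ map (pre true) (bulkMoves q (false ∷ xs))
bulkMoves q (false ∷ true ∷ xs)     =
  (true ∷ false ∷ xs , q) ∷ map (pre false) (bulkMoves q (true ∷ xs))
bulkMoves q (x ∷ y ∷ xs)            = map (pre x) (bulkMoves q (y ∷ xs))

entryMoves : (α : ℚ) → {n : ℕ} → Config n → List (Config n × ℚ)
entryMoves α []           = []
entryMoves α (false ∷ xs) = (true ∷ xs , α) ∷ []
entryMoves α (true ∷ xs)  = []

exitMoves : (β : ℚ) → {n : ℕ} → Config n → List (Config n × ℚ)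
exitMoves β []             = []
exitMoves β (true ∷ [])    = (false ∷ [] , β) ∷ []
exitMoves β (false ∷ [])   = []
exitMoves β (x ∷ y ∷ xs)   = map (pre x) (exitMoves β (y ∷ xs))

moves : (α β q : ℚ) → {n : ℕ} → Config n → List (Config n × ℚ)
moves α β q X = entryMoves α X Data.List.++ (bulkMoves q X Data.List.++ exitMoves β X)

offDiag : (n : ℕ) (α β q : ℚ) → Config n → Config n → ℚ
offDiag n α β q X Y =
  sumL (λ m → if does (proj₁ m ≟C Y) then proj₂ m * ((+ 1) / suc n) else 0ℚ)
       (moves α β q X)

P : (n : ℕ) (α β q : ℚ) → Config n → Config n → ℚ
P n α β q X Y with X ≟C Y
... | no _  = offDiag n α β q X Y
... | yes _ = 1ℚ - sumL (λ Y' → if does (X ≟C Y') then 0ℚ else offDiag n α β q X Y')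
                        (allConfigs n)

record IsStationary (n : ℕ) (α β q : ℚ) (π : Config n → ℚ) : Set where
  field
    nonneg    : ∀ X → 0ℚ ≤ π X
    normalised : sumL π (allConfigs n) ≡ 1ℚ
    balance   : ∀ Y → sumL (λ X → π X * P n α β q X Y) (allConfigs n) ≡ π Y

data Step : Set where
  N S E Ē : Step

allPaths : (n : ℕ) → List (Vec Step n)
allPaths zero    = [] ∷ []
allPaths (suc n) = concatMap (λ v → (N ∷ v) ∷ (S ∷ v) ∷ (E ∷ v) ∷ (Ē ∷ v) ∷ []) (allPaths n)

qint : ℚ → ℕ → ℚ
qint q zero    = 0ℚ
qint q (suc m) = 1ℚ + q * qint q m

validFrom : {n : ℕ} → ℕ → Vec Step n → Bool
validFrom zero    []       = true
validFrom (suc h) []       = false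
validFrom h       (N ∷ cs) = validFrom (suc h) cs
validFrom zero    (S ∷ cs) = false
validFrom (suc h) (S ∷ cs) = validFrom h cs
validFrom h       (E ∷ cs) = validFrom h cs
validFrom h       (Ē ∷ cs) = validFrom h cs

isMotzkin : {n : ℕ} → Vec Step n → Bool
isMotzkin = validFrom 0

-- weight from current height h: each step ending at height h' has weight [h'+1]
weightFrom : (q : ℚ) → {n : ℕ} → ℕ → Vec Step n → ℚ
weightFrom q h       []       = 1ℚ
weightFrom q h       (N ∷ cs) = qint q (suc (suc h)) * weightFrom q (suc h) cs
weightFrom q zero    (S ∷ cs) = qint q 1 * weightFrom q zero cs   -- unreachable for valid paths
weightFrom q (suc h) (S ∷ cs) = qint q (suc h) * weightFrom q h cs
weightFrom q h       (E ∷ cs) = qint q (suc h) * weightFrom q h cs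
weightFrom q h       (Ē ∷ cs) = qint q (suc h) * weightFrom q h cs

weight : (q : ℚ) → {n : ℕ} → Vec Step n → ℚ
weight q = weightFrom q 0

stepType : Bool → Step → Bool
stepType true  N = true
stepType true  E = true
stepType false S = true
stepType false Ē = true
stepType _     _ = false

hasType : {n : ℕ} → Config n → Vec Step n → Bool
hasType []       []       = true
hasType (t ∷ ts) (c ∷ cs) = stepType t c ∧ hasType ts cs

F''' : (q : ℚ) → {n : ℕ} → Config n → ℚ
F''' q {n} τ = sumL (λ c → if isMotzkin c ∧ hasType τ c then weight q c else 0ℚ) (allPaths n)

Z : (q : ℚ) → (n : ℕ) → ℚ
Z q n = sumL (F''' q) (allConfigs n)

{-# OPTIONS --safe #-}

-- The weights are those of the matrix ansatz: for the tridiagonal matrices D, E indexed by heights,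
-- D E - q E D = D + E, ⟨0| E = ⟨0| and D |0⟩ = |0⟩, and ⟨0| X_τ₁ ⋯ X_τₙ |0⟩ is, row by row, the
-- sum over bicolored Motzkin paths of type τ, the entries of D and E being the step weights.
-- These relations make the in-flow of every configuration equal to its out-flow: the defect of
-- each local move is a difference of two words in which one letter is replaced by a scalar
-- D̂ = -1 or Ê = 1, and the defects telescope from the left boundary to the right one.
-- Uniqueness: the moves of rate 1 (entries, right hops, exits) already connect all configurations,
-- and if π and the positive F both balance their flows then, at a maximum of π / F, in-flow
-- equality forces every predecessor to be a maximum too, so π / F is constant.

module Submission where

open import Defs
open import Data.Nat using (ℕ; _≥_)
open import Data.Rational using (ℚ; 0ℚ; 1ℚ; _≤_)
open import Data.Product using (_×_)
open import Relation.Binary.PropositionalEquality using (_≡_)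

open import Data.Bool using (Bool; true; false; not; _∧_; if_then_else_)
import Data.Bool.Properties as BP
open import Data.Empty using (⊥-elim)
import Data.Integer as ℤ
open import Data.List using (List; []; _∷_; _++_; map; concatMap)
import Data.List.Properties as ListP
open import Data.List.Membership.Propositional using (_∈_)
open import Data.List.Membership.Propositional.Properties using (∈-++⁺ʳ; ∈-map⁺; ∈-concatMap⁺)
open import Data.List.Relation.Unary.All as All using (All; []; _∷_)
import Data.List.Relation.Unary.All.Properties as AllP
open import Data.List.Relation.Unary.Any as Any using (here; there)
open import Data.Nat as ℕ using (zero; suc; _∸_)
open import Data.Product using (Σ; _,_; proj₁; proj₂)
import Data.Rational as Q
open import Data.Rational using (_+_; _*_; _-_; -_; _<_; _/_; 1/_)
import Data.Rational.Properties as QP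
open import Data.Vec using (Vec; []; _∷_; replicate)
open import Level using (0ℓ)
open import Relation.Binary.Bundles using (DecTotalOrder)
open import Relation.Binary.Construct.Closure.ReflexiveTransitive as Star using (Star; ε; _◅_; _◅◅_)
open import Relation.Binary.PropositionalEquality
  using (refl; sym; trans; cong; cong₂; subst; module ≡-Reasoning)
open import Relation.Nullary using (yes; no; does)
open import Relation.Nullary.Decidable using (dec⇒maybe)
open import Tactic.RingSolver using (solve-∀)
open import Tactic.RingSolver.Core.AlmostCommutativeRing using (AlmostCommutativeRing; fromCommutativeRing)

open import Data.List.Extrema (DecTotalOrder.totalOrder QP.≤-decTotalOrder) using (argmax; f[xs]≤f[argmax])

open ≡-Reasoning

ℚ-ring : AlmostCommutativeRing 0ℓ 0ℓ
ℚ-ring = fromCommutativeRing QP.+-*-commutativeRing (λ x → dec⇒maybe (0ℚ QP.≟ x))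

x≤x+y : ∀ {x y} → 0ℚ ≤ y → x ≤ x + y
x≤x+y {x} {y} 0≤y = subst (_≤ x + y) (QP.+-identityʳ x) (QP.+-monoʳ-≤ x 0≤y)

y≤x+y : ∀ {x y} → 0ℚ ≤ x → y ≤ x + y
y≤x+y {x} {y} 0≤x = subst (_≤ x + y) (QP.+-identityˡ y) (QP.+-monoˡ-≤ y 0≤x)

0≤* : ∀ {x y} → 0ℚ ≤ x → 0ℚ ≤ y → 0ℚ ≤ x * y
0≤* {x} {y} 0≤x 0≤y =
  QP.nonNegative⁻¹ _ {{QP.nonNeg*nonNeg⇒nonNeg x {{Q.nonNegative 0≤x}} y {{Q.nonNegative 0≤y}}}}

0≤1 : 0ℚ ≤ 1ℚ
0≤1 = QP.<⇒≤ (QP.positive⁻¹ 1ℚ)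

*-monoˡ-≤-0≤ : ∀ {x y z} → 0ℚ ≤ x → y ≤ z → x * y ≤ x * z
*-monoˡ-≤-0≤ {x} 0≤x = QP.*-monoˡ-≤-nonNeg x {{Q.nonNegative 0≤x}}

*-cancelˡ-nonZero : ∀ {x y} c .{{_ : Q.NonZero c}} → c * x ≡ c * y → x ≡ y
*-cancelˡ-nonZero {x} {y} c cx≡cy = begin
  x                  ≡⟨ undo x ⟨
  1/ c * (c * x)     ≡⟨ cong (1/ c *_) cx≡cy ⟩
  1/ c * (c * y)     ≡⟨ undo y ⟩
  y                  ∎
  where
  undo : ∀ z → 1/ c * (c * z) ≡ z
  undo z = trans (sym (QP.*-assoc (1/ c) c z)) (trans (cong (_* z) (QP.*-inverseˡ c)) (QP.*-identityˡ z))

+-≤-≡⇒≡ : ∀ {a b c d} → a ≤ b → c ≤ d → a + c ≡ b + d → a ≡ b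
+-≤-≡⇒≡ a≤b c≤d eq =
  QP.≤-antisym a≤b (QP.≮⇒≥ λ a<b → QP.<-irrefl eq (QP.+-mono-<-≤ a<b c≤d))

if-*ˡ : ∀ b (k x : ℚ) → (if b then k * x else 0ℚ) ≡ k * (if b then x else 0ℚ)
if-*ˡ true  k x = refl
if-*ˡ false k x = sym (QP.*-zeroʳ k)

if-*ʳ : ∀ b (x k : ℚ) → (if b then x * k else 0ℚ) ≡ (if b then x else 0ℚ) * k
if-*ʳ true  x k = refl
if-*ʳ false x k = sym (QP.*-zeroˡ k)

module _ {A : Set} where

  sumL-cong : {f g : A → ℚ} → (∀ a → f a ≡ g a) → ∀ xs → sumL f xs ≡ sumL g xs
  sumL-cong f≗g []       = refl
  sumL-cong f≗g (x ∷ xs) = cong₂ _+_ (f≗g x) (sumL-cong f≗g xs)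

  sumL-++ : ∀ (f : A → ℚ) xs ys → sumL f (xs ++ ys) ≡ sumL f xs + sumL f ys
  sumL-++ f []       ys = sym (QP.+-identityˡ _)
  sumL-++ f (x ∷ xs) ys = trans (cong (f x +_) (sumL-++ f xs ys)) (sym (QP.+-assoc (f x) _ _))

  sumL-0 : ∀ xs → sumL (λ (_ : A) → 0ℚ) xs ≡ 0ℚ
  sumL-0 []       = refl
  sumL-0 (x ∷ xs) = trans (QP.+-identityˡ _) (sumL-0 xs)

  sumL-+ : ∀ (f g : A → ℚ) xs → sumL (λ a → f a + g a) xs ≡ sumL f xs + sumL g xs
  sumL-+ f g []       = refl
  sumL-+ f g (x ∷ xs) = trans (cong (f x + g x +_) (sumL-+ f g xs)) (interchange (f x) (g x) _ _)
    where
    interchange : ∀ a b c d → a + b + (c + d) ≡ a + c + (b + d)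
    interchange = solve-∀ ℚ-ring

  sumL-*ˡ : ∀ k (f : A → ℚ) xs → sumL (λ a → k * f a) xs ≡ k * sumL f xs
  sumL-*ˡ k f []       = sym (QP.*-zeroʳ k)
  sumL-*ˡ k f (x ∷ xs) = trans (cong (k * f x +_) (sumL-*ˡ k f xs)) (sym (QP.*-distribˡ-+ k (f x) _))

  sumL-*ʳ : ∀ k (f : A → ℚ) xs → sumL (λ a → f a * k) xs ≡ sumL f xs * k
  sumL-*ʳ k f xs =
    trans (sumL-cong (λ a → QP.*-comm (f a) k) xs) (trans (sumL-*ˡ k f xs) (QP.*-comm k _))

  sumL-mono-≤ : {f g : A → ℚ} {xs : List A} → All (λ a → f a ≤ g a) xs → sumL f xs ≤ sumL g xs
  sumL-mono-≤ []            = QP.≤-refl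
  sumL-mono-≤ (fx≤gx ∷ f≤g) = QP.+-mono-≤ fx≤gx (sumL-mono-≤ f≤g)

  sumL-nonneg : {f : A → ℚ} {xs : List A} → All (λ a → 0ℚ ≤ f a) xs → 0ℚ ≤ sumL f xs
  sumL-nonneg []           = QP.≤-refl
  sumL-nonneg (0≤fx ∷ 0≤f) = QP.+-mono-≤ 0≤fx (sumL-nonneg 0≤f)

  term≤sumL : {f : A → ℚ} {xs : List A} → All (λ a → 0ℚ ≤ f a) xs →
              ∀ {a} → a ∈ xs → f a ≤ sumL f xs
  term≤sumL (_    ∷ 0≤f) (here refl)  = x≤x+y (sumL-nonneg 0≤f)
  term≤sumL (0≤fx ∷ 0≤f) (there a∈xs) = QP.≤-trans (term≤sumL 0≤f a∈xs) (y≤x+y 0≤fx)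

  sumL-≤-tight : {f g : A → ℚ} {xs : List A} → All (λ a → f a ≤ g a) xs → sumL f xs ≡ sumL g xs →
                 ∀ {a} → a ∈ xs → f a ≡ g a
  sumL-≤-tight (fx≤gx ∷ f≤g) eq (here refl)  = +-≤-≡⇒≡ fx≤gx (sumL-mono-≤ f≤g) eq
  sumL-≤-tight {f} {g} {x ∷ xs} (fx≤gx ∷ f≤g) eq (there a∈xs) = sumL-≤-tight f≤g tail-eq a∈xs
    where
    tail-eq : sumL f xs ≡ sumL g xs
    tail-eq = +-≤-≡⇒≡ (sumL-mono-≤ f≤g) fx≤gx (trans (QP.+-comm _ (f x)) (trans eq (QP.+-comm (g x) _)))

sumL-map : {A B : Set} (f : B → ℚ) (g : A → B) (xs : List A) →
           sumL f (map g xs) ≡ sumL (λ a → f (g a)) xs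
sumL-map f g []       = refl
sumL-map f g (x ∷ xs) = cong (f (g x) +_) (sumL-map f g xs)

sumL-concatMap : {A B : Set} (f : B → ℚ) (g : A → List B) (xs : List A) →
                 sumL f (concatMap g xs) ≡ sumL (λ a → sumL f (g a)) xs
sumL-concatMap f g []       = refl
sumL-concatMap f g (x ∷ xs) = trans (sumL-++ f (g x) _) (cong (sumL f (g x) +_) (sumL-concatMap f g xs))

sumL-swap : {A B : Set} (h : A → B → ℚ) (xs : List A) (ys : List B) →
            sumL (λ a → sumL (h a) ys) xs ≡ sumL (λ b → sumL (λ a → h a b) xs) ys
sumL-swap h []       ys = sym (sumL-0 ys)
sumL-swap h (x ∷ xs) ys = trans (cong (sumL (h x) ys +_) (sumL-swap h xs ys)) (sym (sumL-+ (h x) _ ys))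

does-sym : ∀ {n} (X Y : Config n) → does (X ≟C Y) ≡ does (Y ≟C X)
does-sym X Y with X ≟C Y | Y ≟C X
... | yes _   | yes _   = refl
... | no  _   | no  _   = refl
... | yes X≡Y | no  Y≢X = ⊥-elim (Y≢X (sym X≡Y))
... | no  X≢Y | yes Y≡X = ⊥-elim (X≢Y (sym Y≡X))

δ-sum : ∀ {n} (f : Config n → ℚ) (X : Config n) →
        sumL (λ Y → if does (X ≟C Y) then f Y else 0ℚ) (allConfigs n) ≡ f X
δ-sum f [] = QP.+-identityʳ (f [])
δ-sum {suc n} f (b ∷ X) = begin
    sumL (δ (b ∷ X)) (concatMap bits (allConfigs n))
  ≡⟨ sumL-concatMap (δ (b ∷ X)) bits (allConfigs n) ⟩
    sumL (λ Y → sumL (δ (b ∷ X)) (bits Y)) (allConfigs n)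
  ≡⟨ sumL-cong (pair b) (allConfigs n) ⟩
    sumL (λ Y → if does (X ≟C Y) then f (b ∷ Y) else 0ℚ) (allConfigs n)
  ≡⟨ δ-sum (λ Y → f (b ∷ Y)) X ⟩
    f (b ∷ X)
  ∎
  where
  δ : Config (suc n) → Config (suc n) → ℚ
  δ X Y = if does (X ≟C Y) then f Y else 0ℚ
  bits : Config n → List (Config (suc n))
  bits Y = (false ∷ Y) ∷ (true ∷ Y) ∷ []
  pair : ∀ b Y → sumL (δ (b ∷ X)) (bits Y) ≡ (if does (X ≟C Y) then f (b ∷ Y) else 0ℚ)
  pair false Y = QP.+-identityʳ _
  pair true  Y = trans (QP.+-identityˡ _) (QP.+-identityʳ _)

δ-sum′ : ∀ {n} (f : Config n → ℚ) (X : Config n) →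
         sumL (λ Y → if does (Y ≟C X) then f Y else 0ℚ) (allConfigs n) ≡ f X
δ-sum′ {n} f X =
  trans (sumL-cong (λ Y → cong (λ b → if b then f Y else 0ℚ) (does-sym Y X)) (allConfigs n)) (δ-sum f X)

∈-allConfigs : ∀ {n} (X : Config n) → X ∈ allConfigs n
∈-allConfigs []          = here refl
∈-allConfigs (false ∷ X) = ∈-concatMap⁺ _ (Any.map (λ { refl → here refl }) (∈-allConfigs X))
∈-allConfigs (true ∷ X)  = ∈-concatMap⁺ _ (Any.map (λ { refl → there (here refl) }) (∈-allConfigs X))

empty : ∀ n → Config n
empty n = replicate n false

sumL-positive : ∀ {n} {f : Config n → ℚ} → (∀ X → 0ℚ < f X) → 0ℚ < sumL f (allConfigs n)
sumL-positive {n} f>0 =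
  QP.<-≤-trans (f>0 (empty n))
               (term≤sumL (All.tabulate λ {X} _ → QP.<⇒≤ (f>0 X)) (∈-allConfigs (empty n)))

-- Moves of the PASEP

prepend : ∀ {n} → Bool → Config n × ℚ → Config (suc n) × ℚ
prepend b (X , r) = b ∷ X , r

rateTerm : ∀ {n} → Config n → Config n × ℚ → ℚ
rateTerm Y m = if does (proj₁ m ≟C Y) then proj₂ m else 0ℚ

rateTo : ∀ {n} → List (Config n × ℚ) → Config n → ℚ
rateTo L Y = sumL (rateTerm Y) L

totalRate : ∀ {n} → List (Config n × ℚ) → ℚ
totalRate = sumL proj₂

flux : ∀ {n} → (Config n → ℚ) → List (Config n × ℚ) → ℚ
flux f = sumL (λ m → proj₂ m * f (proj₁ m))

swapOut : ℚ → ∀ {n} → Bool → Bool → Config n → List (Config (suc (suc n)) × ℚ)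
swapOut q true  false X = (false ∷ true ∷ X , 1ℚ) ∷ []
swapOut q false true  X = (true ∷ false ∷ X , q) ∷ []
swapOut q true  true  X = []
swapOut q false false X = []

swapIn : ℚ → ∀ {n} → Bool → Bool → Config n → List (Config (suc (suc n)) × ℚ)
swapIn q true  false Y = (false ∷ true ∷ Y , q) ∷ []
swapIn q false true  Y = (true ∷ false ∷ Y , 1ℚ) ∷ []
swapIn q true  true  Y = []
swapIn q false false Y = []

rightOut : (β q : ℚ) → ∀ {n} → Config n → List (Config n × ℚ)
rightOut β q X = bulkMoves q X ++ exitMoves β X

rightIn : (β q : ℚ) → ∀ {n} → Config n → List (Config n × ℚ)
rightIn β q []           = []
rightIn β q (a ∷ b ∷ Y)  = swapIn q a b Y ++ map (prepend a) (rightIn β q (b ∷ Y))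
rightIn β q (true ∷ [])  = []
rightIn β q (false ∷ []) = (true ∷ [] , β) ∷ []

entryIn : (α : ℚ) → ∀ {n} → Config n → List (Config n × ℚ)
entryIn α []          = []
entryIn α (true ∷ Y)  = (false ∷ Y , α) ∷ []
entryIn α (false ∷ Y) = []

inMoves : (α β q : ℚ) → ∀ {n} → Config n → List (Config n × ℚ)
inMoves α β q Y = entryIn α Y ++ rightIn β q Y

outRate : (α β q : ℚ) → ∀ {n} → Config n → ℚ
outRate α β q X = totalRate (moves α β q X)

flux-cong : ∀ {n} {f g : Config n → ℚ} → (∀ X → f X ≡ g X) → ∀ L → flux f L ≡ flux g L
flux-cong f≗g = sumL-cong (λ m → cong (proj₂ m *_) (f≗g (proj₁ m)))

flux-++ : ∀ {n} (f : Config n → ℚ) L L′ → flux f (L ++ L′) ≡ flux f L + flux f L′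
flux-++ f = sumL-++ (λ m → proj₂ m * f (proj₁ m))

flux-*ʳ : ∀ {n} (f : Config n → ℚ) c L → flux (λ X → f X * c) L ≡ flux f L * c
flux-*ʳ f c L = trans (sumL-cong (λ m → sym (QP.*-assoc (proj₂ m) (f (proj₁ m)) c)) L)
                      (sumL-*ʳ c (λ m → proj₂ m * f (proj₁ m)) L)

totalRate-++ : ∀ {n} (L L′ : List (Config n × ℚ)) → totalRate (L ++ L′) ≡ totalRate L + totalRate L′
totalRate-++ = sumL-++ proj₂

totalRate-prepend : ∀ {n} a (L : List (Config n × ℚ)) → totalRate (map (prepend a) L) ≡ totalRate L
totalRate-prepend a = sumL-map proj₂ (prepend a)

rightOut-cons : ∀ β q {n} a b (X : Config n) →
  rightOut β q (a ∷ b ∷ X) ≡ swapOut q a b X ++ map (prepend a) (rightOut β q (b ∷ X))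
rightOut-cons β q a b X = begin
    bulkMoves q (a ∷ b ∷ X) ++ exitMoves β (a ∷ b ∷ X)
  ≡⟨ cong₂ _++_ (bulk a b) (exit a) ⟩
    (swapOut q a b X ++ map (prepend a) (bulkMoves q (b ∷ X))) ++ map (prepend a) (exitMoves β (b ∷ X))
  ≡⟨ ListP.++-assoc (swapOut q a b X) _ _ ⟩
    swapOut q a b X ++ (map (prepend a) (bulkMoves q (b ∷ X)) ++ map (prepend a) (exitMoves β (b ∷ X)))
  ≡⟨ cong (swapOut q a b X ++_) (ListP.map-++ (prepend a) (bulkMoves q (b ∷ X)) _) ⟨
    swapOut q a b X ++ map (prepend a) (rightOut β q (b ∷ X))
  ∎
  where
  bulk : ∀ a b → bulkMoves q (a ∷ b ∷ X) ≡ swapOut q a b X ++ map (prepend a) (bulkMoves q (b ∷ X))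
  bulk true  true  = refl
  bulk true  false = refl
  bulk false true  = refl
  bulk false false = refl
  exit : ∀ a → exitMoves β (a ∷ b ∷ X) ≡ map (prepend a) (exitMoves β (b ∷ X))
  exit true  = refl
  exit false = refl

rateTo-++ : ∀ {n} (L L′ : List (Config n × ℚ)) Y → rateTo (L ++ L′) Y ≡ rateTo L Y + rateTo L′ Y
rateTo-++ L L′ Y = sumL-++ (rateTerm Y) L L′

rateTo-prepend-same : ∀ {n} a (L : List (Config n × ℚ)) Y →
                      rateTo (map (prepend a) L) (a ∷ Y) ≡ rateTo L Y
rateTo-prepend-same true  L Y = sumL-map (rateTerm (true ∷ Y)) (prepend true) L
rateTo-prepend-same false L Y = sumL-map (rateTerm (false ∷ Y)) (prepend false) L

rateTo-prepend-other : ∀ {n} a (L : List (Config n × ℚ)) Y →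
                       rateTo (map (prepend a) L) (not a ∷ Y) ≡ 0ℚ
rateTo-prepend-other true  L Y = trans (sumL-map (rateTerm (false ∷ Y)) (prepend true) L) (sumL-0 L)
rateTo-prepend-other false L Y = trans (sumL-map (rateTerm (true ∷ Y)) (prepend false) L) (sumL-0 L)

rateTo-prepend-dual : ∀ {n} a b (L L′ : List (Config n × ℚ)) X Y → rateTo L Y ≡ rateTo L′ X →
  rateTo (map (prepend a) L) (b ∷ Y) ≡ rateTo (map (prepend b) L′) (a ∷ X)
rateTo-prepend-dual true  true  L L′ X Y eq =
  trans (rateTo-prepend-same true L Y) (trans eq (sym (rateTo-prepend-same true L′ X)))
rateTo-prepend-dual false false L L′ X Y eq =
  trans (rateTo-prepend-same false L Y) (trans eq (sym (rateTo-prepend-same false L′ X)))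
rateTo-prepend-dual true  false L L′ X Y _ =
  trans (rateTo-prepend-other true L Y) (sym (rateTo-prepend-other false L′ X))
rateTo-prepend-dual false true  L L′ X Y _ =
  trans (rateTo-prepend-other false L Y) (sym (rateTo-prepend-other true L′ X))

entry-dual : ∀ α {n} (X Y : Config n) → rateTo (entryMoves α X) Y ≡ rateTo (entryIn α Y) X
entry-dual α []          []          = refl
entry-dual α (false ∷ X) (true ∷ Y)  = cong (λ b → (if b then α else 0ℚ) + 0ℚ) (does-sym X Y)
entry-dual α (false ∷ X) (false ∷ Y) = refl
entry-dual α (true ∷ X)  (true ∷ Y)  = refl
entry-dual α (true ∷ X)  (false ∷ Y) = refl

swap-dual : ∀ q {n} a b c d (X Y : Config n) →
  rateTo (swapOut q a b X) (c ∷ d ∷ Y) ≡ rateTo (swapIn q c d Y) (a ∷ b ∷ X)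
swap-dual q true  false false true  X Y = cong (λ b → (if b then 1ℚ else 0ℚ) + 0ℚ) (does-sym X Y)
swap-dual q false true  true  false X Y = cong (λ b → (if b then q else 0ℚ) + 0ℚ) (does-sym X Y)
swap-dual q true  true  true  true  X Y = refl
swap-dual q true  true  true  false X Y = refl
swap-dual q true  true  false true  X Y = refl
swap-dual q true  true  false false X Y = refl
swap-dual q true  false true  true  X Y = refl
swap-dual q true  false true  false X Y = refl
swap-dual q true  false false false X Y = refl
swap-dual q false true  true  true  X Y = refl
swap-dual q false true  false true  X Y = refl
swap-dual q false true  false false X Y = refl
swap-dual q false false true  true  X Y = refl
swap-dual q false false true  false X Y = refl
swap-dual q false false false true  X Y = refl
swap-dual q false false false false X Y = refl

right-dual : ∀ β q {n} (X Y : Config n) → rateTo (rightOut β q X) Y ≡ rateTo (rightIn β q Y) X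
right-dual β q []           []           = refl
right-dual β q (true ∷ [])  (true ∷ [])  = refl
right-dual β q (true ∷ [])  (false ∷ []) = refl
right-dual β q (false ∷ []) (true ∷ [])  = refl
right-dual β q (false ∷ []) (false ∷ []) = refl
right-dual β q (a ∷ b ∷ X)  (c ∷ d ∷ Y)  = begin
    rateTo (rightOut β q (a ∷ b ∷ X)) (c ∷ d ∷ Y)
  ≡⟨ cong (λ L → rateTo L (c ∷ d ∷ Y)) (rightOut-cons β q a b X) ⟩
    rateTo (swapOut q a b X ++ map (prepend a) (rightOut β q (b ∷ X))) (c ∷ d ∷ Y)
  ≡⟨ rateTo-++ (swapOut q a b X) _ _ ⟩
    rateTo (swapOut q a b X) (c ∷ d ∷ Y) + rateTo (map (prepend a) (rightOut β q (b ∷ X))) (c ∷ d ∷ Y)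
  ≡⟨ cong₂ _+_ (swap-dual q a b c d X Y)
               (rateTo-prepend-dual a c (rightOut β q (b ∷ X)) (rightIn β q (d ∷ Y)) (b ∷ X) (d ∷ Y)
                                    (right-dual β q (b ∷ X) (d ∷ Y))) ⟩
    rateTo (swapIn q c d Y) (a ∷ b ∷ X) + rateTo (map (prepend c) (rightIn β q (d ∷ Y))) (a ∷ b ∷ X)
  ≡⟨ rateTo-++ (swapIn q c d Y) _ _ ⟨
    rateTo (rightIn β q (c ∷ d ∷ Y)) (a ∷ b ∷ X)
  ∎

rateTo-dual : ∀ α β q {n} (X Y : Config n) → rateTo (moves α β q X) Y ≡ rateTo (inMoves α β q Y) X
rateTo-dual α β q X Y = begin
    rateTo (moves α β q X) Y
  ≡⟨ rateTo-++ (entryMoves α X) _ Y ⟩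
    rateTo (entryMoves α X) Y + rateTo (rightOut β q X) Y
  ≡⟨ cong₂ _+_ (entry-dual α X Y) (right-dual β q X Y) ⟩
    rateTo (entryIn α Y) X + rateTo (rightIn β q Y) X
  ≡⟨ rateTo-++ (entryIn α Y) _ X ⟨
    rateTo (inMoves α β q Y) X
  ∎

right-noLoop : ∀ β q {n} (X : Config n) → rateTo (rightOut β q X) X ≡ 0ℚ
right-noLoop β q []           = refl
right-noLoop β q (true ∷ [])  = refl
right-noLoop β q (false ∷ []) = refl
right-noLoop β q (a ∷ b ∷ X)  = begin
    rateTo (rightOut β q (a ∷ b ∷ X)) (a ∷ b ∷ X)
  ≡⟨ cong (λ L → rateTo L (a ∷ b ∷ X)) (rightOut-cons β q a b X) ⟩
    rateTo (swapOut q a b X ++ map (prepend a) (rightOut β q (b ∷ X))) (a ∷ b ∷ X)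
  ≡⟨ rateTo-++ (swapOut q a b X) _ _ ⟩
    rateTo (swapOut q a b X) (a ∷ b ∷ X) + rateTo (map (prepend a) (rightOut β q (b ∷ X))) (a ∷ b ∷ X)
  ≡⟨ cong₂ _+_ (swap-noLoop a b)
               (trans (rateTo-prepend-same a (rightOut β q (b ∷ X)) (b ∷ X)) (right-noLoop β q (b ∷ X))) ⟩
    0ℚ
  ∎
  where
  swap-noLoop : ∀ a b → rateTo (swapOut q a b X) (a ∷ b ∷ X) ≡ 0ℚ
  swap-noLoop true  true  = refl
  swap-noLoop true  false = refl
  swap-noLoop false true  = refl
  swap-noLoop false false = refl

moves-noLoop : ∀ α β q {n} (X : Config n) → rateTo (moves α β q X) X ≡ 0ℚ
moves-noLoop α β q X =
  trans (rateTo-++ (entryMoves α X) _ X) (cong₂ _+_ (entry-noLoop X) (right-noLoop β q X))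
  where
  entry-noLoop : ∀ {n} (X : Config n) → rateTo (entryMoves α X) X ≡ 0ℚ
  entry-noLoop []          = refl
  entry-noLoop (true ∷ X)  = refl
  entry-noLoop (false ∷ X) = refl

inMoves-nonneg : ∀ {α β q} → 0ℚ ≤ α → 0ℚ ≤ β → 0ℚ ≤ q →
                 ∀ {n} (Y : Config n) → All (λ m → 0ℚ ≤ proj₂ m) (inMoves α β q Y)
inMoves-nonneg {α} {β} {q} 0≤α 0≤β 0≤q Y = AllP.++⁺ (entry Y) (right Y)
  where
  entry : ∀ {n} (Y : Config n) → All (λ m → 0ℚ ≤ proj₂ m) (entryIn α Y)
  entry []          = []
  entry (true ∷ Y)  = 0≤α ∷ []
  entry (false ∷ Y) = []
  swap : ∀ {n} a b (Y : Config n) → All (λ m → 0ℚ ≤ proj₂ m) (swapIn q a b Y)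
  swap true  false Y = 0≤q ∷ []
  swap false true  Y = 0≤1 ∷ []
  swap true  true  Y = []
  swap false false Y = []
  right : ∀ {n} (Y : Config n) → All (λ m → 0ℚ ≤ proj₂ m) (rightIn β q Y)
  right []           = []
  right (a ∷ b ∷ Y)  = AllP.++⁺ (swap a b Y) (AllP.map⁺ (right (b ∷ Y)))
  right (true ∷ [])  = []
  right (false ∷ []) = 0≤β ∷ []

-- Stationarity as a balance of flows

rateScale : ℕ → ℚ
rateScale n = ℤ.+ 1 / suc n

rateScale-nonZero : ∀ n → Q.NonZero (rateScale n)
rateScale-nonZero n = QP.pos⇒nonZero (rateScale n) {{QP.normalize-pos 1 (suc n)}}

sumL-*-rateTo : ∀ {n} (g : Config n → ℚ) (L : List (Config n × ℚ)) →
                sumL (λ X → g X * rateTo L X) (allConfigs n) ≡ flux g L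
sumL-*-rateTo {n} g L = begin
    sumL (λ X → g X * rateTo L X) (allConfigs n)
  ≡⟨ sumL-cong (λ X → sumL-*ˡ (g X) (rateTerm X) L) (allConfigs n) ⟨
    sumL (λ X → sumL (λ m → g X * rateTerm X m) L) (allConfigs n)
  ≡⟨ sumL-swap (λ X m → g X * rateTerm X m) (allConfigs n) L ⟩
    sumL (λ m → sumL (λ X → g X * rateTerm X m) (allConfigs n)) L
  ≡⟨ sumL-cong (λ m → trans (sym (sumL-cong (λ X → if-*ˡ (does (proj₁ m ≟C X)) (g X) (proj₂ m))
                                             (allConfigs n)))
                            (trans (δ-sum (λ X → g X * proj₂ m) (proj₁ m)) (QP.*-comm _ (proj₂ m)))) L ⟩
    flux g L
  ∎

FlowBalanced : (α β q : ℚ) → ∀ {n} → (Config n → ℚ) → Set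
FlowBalanced α β q π = ∀ Y → flux π (inMoves α β q Y) ≡ π Y * outRate α β q Y

module _ (α β q : ℚ) where

  offDiag-rate : ∀ {n} (X Y : Config n) → offDiag n α β q X Y ≡ rateTo (moves α β q X) Y * rateScale n
  offDiag-rate {n} X Y =
    trans (sumL-cong (λ m → if-*ʳ (does (proj₁ m ≟C Y)) (proj₂ m) (rateScale n)) (moves α β q X))
          (sumL-*ʳ (rateScale n) (rateTerm Y) (moves α β q X))

  offDiag-diagonal : ∀ {n} (X : Config n) → offDiag n α β q X X ≡ 0ℚ
  offDiag-diagonal {n} X =
    trans (offDiag-rate X X) (trans (cong (_* rateScale n) (moves-noLoop α β q X)) (QP.*-zeroˡ (rateScale n)))

  offDiag-rowSum : ∀ {n} (X : Config n) →
    sumL (λ Y → if does (X ≟C Y) then 0ℚ else offDiag n α β q X Y) (allConfigs n) ≡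
    outRate α β q X * rateScale n
  offDiag-rowSum {n} X = begin
      sumL (λ Y → if does (X ≟C Y) then 0ℚ else offDiag n α β q X Y) (allConfigs n)
    ≡⟨ sumL-cong off-diagonal (allConfigs n) ⟩
      sumL (λ Y → offDiag n α β q X Y) (allConfigs n)
    ≡⟨ sumL-cong (offDiag-rate X) (allConfigs n) ⟩
      sumL (λ Y → rateTo L Y * rateScale n) (allConfigs n)
    ≡⟨ sumL-*ʳ (rateScale n) (rateTo L) (allConfigs n) ⟩
      sumL (rateTo L) (allConfigs n) * rateScale n
    ≡⟨ cong (_* rateScale n) total ⟩
      outRate α β q X * rateScale n
    ∎
    where
    L = moves α β q X
    off-diagonal : ∀ Y → (if does (X ≟C Y) then 0ℚ else offDiag n α β q X Y) ≡ offDiag n α β q X Y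
    off-diagonal Y with X ≟C Y
    ... | no _     = refl
    ... | yes refl = sym (offDiag-diagonal X)
    total : sumL (rateTo L) (allConfigs n) ≡ totalRate L
    total = trans (sumL-cong (λ Y → sym (QP.*-identityˡ (rateTo L Y))) (allConfigs n))
                  (trans (sumL-*-rateTo (λ _ → 1ℚ) L) (sumL-cong (λ m → QP.*-identityʳ (proj₂ m)) L))

  weighted-P-split : ∀ {n} (π : Config n → ℚ) (X Y : Config n) →
    π X * P n α β q X Y ≡
    π X * offDiag n α β q X Y + (if does (X ≟C Y) then π X * (1ℚ - outRate α β q X * rateScale n) else 0ℚ)
  weighted-P-split {n} π X Y with X ≟C Y
  ... | no _     = sym (QP.+-identityʳ _)
  ... | yes refl = begin
      π X * (1ℚ - sumL (λ Y → if does (X ≟C Y) then 0ℚ else offDiag n α β q X Y) (allConfigs n))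
    ≡⟨ cong (λ e → π X * (1ℚ - e)) (offDiag-rowSum X) ⟩
      π X * (1ℚ - outRate α β q X * rateScale n)
    ≡⟨ QP.+-identityˡ _ ⟨
      0ℚ + π X * (1ℚ - outRate α β q X * rateScale n)
    ≡⟨ cong (_+ π X * (1ℚ - outRate α β q X * rateScale n))
            (trans (cong (π X *_) (offDiag-diagonal X)) (QP.*-zeroʳ (π X))) ⟨
      π X * offDiag n α β q X X + π X * (1ℚ - outRate α β q X * rateScale n)
    ∎

  πP-columnSum : ∀ {n} (π : Config n → ℚ) (Y : Config n) →
    sumL (λ X → π X * P n α β q X Y) (allConfigs n) ≡
    flux π (inMoves α β q Y) * rateScale n + π Y * (1ℚ - outRate α β q Y * rateScale n)
  πP-columnSum {n} π Y = begin
      sumL (λ X → π X * P n α β q X Y) (allConfigs n)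
    ≡⟨ sumL-cong (λ X → weighted-P-split π X Y) (allConfigs n) ⟩
      sumL (λ X → π X * offDiag n α β q X Y + diagonal X) (allConfigs n)
    ≡⟨ sumL-+ (λ X → π X * offDiag n α β q X Y) diagonal (allConfigs n) ⟩
      sumL (λ X → π X * offDiag n α β q X Y) (allConfigs n) + sumL diagonal (allConfigs n)
    ≡⟨ cong₂ _+_ inflow (δ-sum′ (λ X → π X * (1ℚ - outRate α β q X * rateScale n)) Y) ⟩
      flux π (inMoves α β q Y) * rateScale n + π Y * (1ℚ - outRate α β q Y * rateScale n)
    ∎
    where
    diagonal : Config n → ℚ
    diagonal X = if does (X ≟C Y) then π X * (1ℚ - outRate α β q X * rateScale n) else 0ℚ
    inflow : sumL (λ X → π X * offDiag n α β q X Y) (allConfigs n) ≡ flux π (inMoves α β q Y) * rateScale n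
    inflow = begin
        sumL (λ X → π X * offDiag n α β q X Y) (allConfigs n)
      ≡⟨ sumL-cong (λ X → cong (π X *_) (trans (offDiag-rate X Y)
                                              (cong (_* rateScale n) (rateTo-dual α β q X Y))))
                   (allConfigs n) ⟩
        sumL (λ X → π X * (rateTo (inMoves α β q Y) X * rateScale n)) (allConfigs n)
      ≡⟨ sumL-cong (λ X → QP.*-assoc (π X) _ (rateScale n)) (allConfigs n) ⟨
        sumL (λ X → π X * rateTo (inMoves α β q Y) X * rateScale n) (allConfigs n)
      ≡⟨ sumL-*ʳ (rateScale n) (λ X → π X * rateTo (inMoves α β q Y) X) (allConfigs n) ⟩
        sumL (λ X → π X * rateTo (inMoves α β q Y) X) (allConfigs n) * rateScale n
      ≡⟨ cong (_* rateScale n) (sumL-*-rateTo π (inMoves α β q Y)) ⟩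
        flux π (inMoves α β q Y) * rateScale n
      ∎

  balanced⇒invariant : ∀ {n} {π : Config n → ℚ} → FlowBalanced α β q π →
                       ∀ Y → sumL (λ X → π X * P n α β q X Y) (allConfigs n) ≡ π Y
  balanced⇒invariant {n} {π} balanced Y = begin
      sumL (λ X → π X * P n α β q X Y) (allConfigs n)
    ≡⟨ πP-columnSum π Y ⟩
      flux π (inMoves α β q Y) * c + π Y * (1ℚ - o * c)
    ≡⟨ cong (λ i → i * c + π Y * (1ℚ - o * c)) (balanced Y) ⟩
      π Y * o * c + π Y * (1ℚ - o * c)
    ≡⟨ cancel (π Y) o c ⟩
      π Y
    ∎
    where
    c = rateScale n
    o = outRate α β q Y
    cancel : ∀ p o c → p * o * c + p * (1ℚ - o * c) ≡ p
    cancel = solve-∀ ℚ-ring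

  invariant⇒balanced : ∀ {n} {π : Config n → ℚ} →
                       (∀ Y → sumL (λ X → π X * P n α β q X Y) (allConfigs n) ≡ π Y) →
                       FlowBalanced α β q π
  invariant⇒balanced {n} {π} invariant Y = *-cancelˡ-nonZero c {{rateScale-nonZero n}} (begin
      c * i
    ≡⟨ expand i p o c ⟩
      (i * c + p * (1ℚ - o * c)) - p + c * (p * o)
    ≡⟨ cong (λ s → s - p + c * (p * o)) (trans (sym (πP-columnSum π Y)) (invariant Y)) ⟩
      p - p + c * (p * o)
    ≡⟨ collapse p o c ⟩
      c * (p * o)
    ∎)
    where
    c = rateScale n
    i = flux π (inMoves α β q Y)
    p = π Y
    o = outRate α β q Y
    expand : ∀ i p o c → c * i ≡ (i * c + p * (1ℚ - o * c)) - p + c * (p * o)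
    expand = solve-∀ ℚ-ring
    collapse : ∀ p o c → p - p + c * (p * o) ≡ c * (p * o)
    collapse = solve-∀ ℚ-ring

  balanced-cong : ∀ {n} {f g : Config n → ℚ} → (∀ X → f X ≡ g X) →
                  FlowBalanced α β q f → FlowBalanced α β q g
  balanced-cong f≗g f-balanced Y =
    trans (sym (flux-cong f≗g (inMoves α β q Y))) (trans (f-balanced Y) (cong (_* outRate α β q Y) (f≗g Y)))

  balanced-*ʳ : ∀ {n} {f : Config n → ℚ} c →
                FlowBalanced α β q f → FlowBalanced α β q (λ X → f X * c)
  balanced-*ʳ {f = f} c f-balanced Y = begin
      flux (λ X → f X * c) (inMoves α β q Y)
    ≡⟨ flux-*ʳ f c (inMoves α β q Y) ⟩
      flux f (inMoves α β q Y) * c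
    ≡⟨ cong (_* c) (f-balanced Y) ⟩
      f Y * outRate α β q Y * c
    ≡⟨ swap (f Y) (outRate α β q Y) c ⟩
      f Y * c * outRate α β q Y
    ∎
    where
    swap : ∀ x y z → x * y * z ≡ x * z * y
    swap = solve-∀ ℚ-ring

-- The matrix ansatz

jump : Bool → ℕ → ℕ
jump true  h = suc h
jump false h = h ∸ 1

jumpWeight : ℚ → Bool → ℕ → ℚ
jumpWeight q true  h = qint q (suc (suc h))
jumpWeight q false h = qint q h

-- Row h of the tridiagonal matrices D = transfer q true and E = transfer q false, applied to the column
-- vector g; for E at h = 0 the junk entry g (0 ∸ 1) is killed by [0] = 0.
transfer : ℚ → Bool → (ℕ → ℚ) → ℕ → ℚ
transfer q a g h = jumpWeight q a h * g (jump a h) + qint q (suc h) * g h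

vacuum : ℕ → ℚ
vacuum zero    = 1ℚ
vacuum (suc h) = 0ℚ

-- ansatz q τ h = ⟨h| X_τ₁ ⋯ X_τₙ |0⟩ with X_true = D, X_false = E.
ansatz : ℚ → ∀ {n} → Config n → ℕ → ℚ
ansatz q []      = vacuum
ansatz q (a ∷ τ) = transfer q a (ansatz q τ)

transfer-cong : ∀ q a {f g : ℕ → ℚ} → (∀ k → f k ≡ g k) →
                ∀ h → transfer q a f h ≡ transfer q a g h
transfer-cong q a f≗g h =
  cong₂ (λ x y → jumpWeight q a h * x + qint q (suc h) * y) (f≗g (jump a h)) (f≗g h)

transfer-*ˡ : ∀ q a c (g : ℕ → ℚ) h → transfer q a (λ k → c * g k) h ≡ c * transfer q a g h
transfer-*ˡ q a c g h = linear (jumpWeight q a h) (qint q (suc h)) c (g (jump a h)) (g h)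
  where
  linear : ∀ κ d c x y → κ * (c * x) + d * (c * y) ≡ c * (κ * x + d * y)
  linear = solve-∀ ℚ-ring

transfer-+ : ∀ q a (f g : ℕ → ℚ) h →
             transfer q a f h + transfer q a g h ≡ transfer q a (λ k → f k + g k) h
transfer-+ q a f g h =
  linear (jumpWeight q a h) (qint q (suc h)) (f (jump a h)) (f h) (g (jump a h)) (g h)
  where
  linear : ∀ κ d x y u v → κ * x + d * y + (κ * u + d * v) ≡ κ * (x + u) + d * (y + v)
  linear = solve-∀ ℚ-ring

transfer-affine : ∀ q a (f g : ℕ → ℚ) c h →
  transfer q a f h - transfer q a g h * c ≡ transfer q a (λ k → f k - g k * c) h
transfer-affine q a f g c h =
  linear (jumpWeight q a h) (qint q (suc h)) (f (jump a h)) (f h) (g (jump a h)) (g h) c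
  where
  linear : ∀ κ d x y u v c → κ * x + d * y - (κ * u + d * v) * c ≡ κ * (x - u * c) + d * (y - v * c)
  linear = solve-∀ ℚ-ring

transfer-sumL : ∀ q a {A : Set} (f : A → ℕ → ℚ) (xs : List A) h →
  sumL (λ x → transfer q a (f x) h) xs ≡ transfer q a (λ k → sumL (λ x → f x k) xs) h
transfer-sumL q a f []       h = zero-row (jumpWeight q a h) (qint q (suc h))
  where
  zero-row : ∀ κ d → 0ℚ ≡ κ * 0ℚ + d * 0ℚ
  zero-row = solve-∀ ℚ-ring
transfer-sumL q a f (x ∷ xs) h =
  trans (cong (transfer q a (f x) h +_) (transfer-sumL q a f xs h))
        (transfer-+ q a (f x) (λ k → sumL (λ y → f y k) xs) h)

-- The boundary conditions ⟨0| E = ⟨0| and D |0⟩ = |0⟩.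
transfer-false-top : ∀ q (g : ℕ → ℚ) → transfer q false g 0 ≡ g 0
transfer-false-top q g = boundary q (g 0)
  where
  boundary : ∀ q x → 0ℚ * x + (1ℚ + q * 0ℚ) * x ≡ x
  boundary = solve-∀ ℚ-ring

transfer-true-vacuum : ∀ q h → transfer q true vacuum h ≡ vacuum h
transfer-true-vacuum q zero    = boundary q
  where
  boundary : ∀ q → (1ℚ + q * (1ℚ + q * 0ℚ)) * 0ℚ + (1ℚ + q * 0ℚ) * 1ℚ ≡ 1ℚ
  boundary = solve-∀ ℚ-ring
transfer-true-vacuum q (suc h) = boundary (qint q (suc (suc (suc h)))) (qint q (suc (suc h)))
  where
  boundary : ∀ κ d → κ * 0ℚ + d * 0ℚ ≡ 0ℚ
  boundary = solve-∀ ℚ-ring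

transfer-DE-relation : ∀ q (g : ℕ → ℚ) h →
  transfer q true (transfer q false g) h ≡
  q * transfer q false (transfer q true g) h + transfer q true g h + transfer q false g h
transfer-DE-relation q g zero    = relation₀ q (g 0) (g 1)
  where
  relation₀ : ∀ q y z → let c₁ = 1ℚ + q * 0ℚ; c₂ = 1ℚ + q * c₁ in
    c₂ * (c₁ * y + c₂ * z) + c₁ * (0ℚ * y + c₁ * y) ≡
    q * (0ℚ * (c₂ * z + c₁ * y) + c₁ * (c₂ * z + c₁ * y)) + (c₂ * z + c₁ * y) + (0ℚ * y + c₁ * y)
  relation₀ = solve-∀ ℚ-ring
transfer-DE-relation q g (suc h) = relation q (qint q (suc h)) (g h) (g (suc h)) (g (suc (suc h)))
  where
  relation : ∀ q c x y z → let c₁ = 1ℚ + q * c; c₂ = 1ℚ + q * c₁ in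
    c₂ * (c₁ * y + c₂ * z) + c₁ * (c * x + c₁ * y) ≡
    q * (c * (c₁ * y + c * x) + c₁ * (c₂ * z + c₁ * y)) + (c₂ * z + c₁ * y) + (c * x + c₁ * y)
  relation = solve-∀ ℚ-ring

pathTerm : ℚ → ∀ {n} → ℕ → Config n → Vec Step n → ℚ
pathTerm q h τ c = if validFrom h c ∧ hasType τ c then weightFrom q h c else 0ℚ

pathSum : ℚ → ∀ {n} → ℕ → Config n → ℚ
pathSum q {n} h τ = sumL (pathTerm q h τ) (allPaths n)

if-∧-false : ∀ b (w : ℚ) → (if b ∧ false then w else 0ℚ) ≡ 0ℚ
if-∧-false b w = cong (if_then w else 0ℚ) (BP.∧-zeroʳ b)

-- Two of the four one-step extensions have the wrong type and vanish; the other two give the two terms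
-- of the transfer row. The height is split because validFrom inspects it before the step.
pathTerm-step : ∀ q {n} a (τ : Config n) (c : Vec Step n) h →
  sumL (pathTerm q h (a ∷ τ)) ((N ∷ c) ∷ (S ∷ c) ∷ (E ∷ c) ∷ (Ē ∷ c) ∷ []) ≡
  transfer q a (λ k → pathTerm q k τ c) h
pathTerm-step q true τ c zero =
  trans (cong₂ _+_ (if-*ˡ (validFrom 1 c ∧ hasType τ c) (qint q 2) (weightFrom q 1 c))
          (cong (0ℚ +_)
            (cong₂ _+_ (if-*ˡ (validFrom 0 c ∧ hasType τ c) (qint q 1) (weightFrom q 0 c))
                       (cong (_+ 0ℚ) (if-∧-false (validFrom 0 c) _)))))
        (drop-zeros (qint q 2 * pathTerm q 1 τ c) (qint q 1 * pathTerm q 0 τ c))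
  where
  drop-zeros : ∀ x y → x + (0ℚ + (y + (0ℚ + 0ℚ))) ≡ x + y
  drop-zeros = solve-∀ ℚ-ring
pathTerm-step q true τ c (suc h) =
  trans (cong₂ _+_ (if-*ˡ (validFrom (2 ℕ.+ h) c ∧ hasType τ c) (qint q (3 ℕ.+ h))
                          (weightFrom q (2 ℕ.+ h) c))
          (cong₂ _+_ (if-∧-false (validFrom h c) _)
            (cong₂ _+_ (if-*ˡ (validFrom (suc h) c ∧ hasType τ c) (qint q (2 ℕ.+ h)) (weightFrom q (suc h) c))
                       (cong (_+ 0ℚ) (if-∧-false (validFrom (suc h) c) _)))))
        (drop-zeros (qint q (3 ℕ.+ h) * pathTerm q (2 ℕ.+ h) τ c) (qint q (2 ℕ.+ h) * pathTerm q (suc h) τ c))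
  where
  drop-zeros : ∀ x y → x + (0ℚ + (y + (0ℚ + 0ℚ))) ≡ x + y
  drop-zeros = solve-∀ ℚ-ring
pathTerm-step q false τ c zero =
  trans (cong₂ _+_ (if-∧-false (validFrom 1 c) _)
          (cong (0ℚ +_)
            (cong₂ _+_ (if-∧-false (validFrom 0 c) _)
                       (cong (_+ 0ℚ) (if-*ˡ (validFrom 0 c ∧ hasType τ c) (qint q 1) (weightFrom q 0 c))))))
        (drop-zeros (pathTerm q 0 τ c) (qint q 1 * pathTerm q 0 τ c))
  where
  drop-zeros : ∀ x y → 0ℚ + (0ℚ + (0ℚ + (y + 0ℚ))) ≡ 0ℚ * x + y
  drop-zeros = solve-∀ ℚ-ring
pathTerm-step q false τ c (suc h) =
  trans (cong₂ _+_ (if-∧-false (validFrom (2 ℕ.+ h) c) _)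
          (cong₂ _+_ (if-*ˡ (validFrom h c ∧ hasType τ c) (qint q (suc h)) (weightFrom q h c))
            (cong₂ _+_ (if-∧-false (validFrom (suc h) c) _)
                       (cong (_+ 0ℚ) (if-*ˡ (validFrom (suc h) c ∧ hasType τ c) (qint q (2 ℕ.+ h))
                                            (weightFrom q (suc h) c))))))
        (drop-zeros (qint q (suc h) * pathTerm q h τ c) (qint q (2 ℕ.+ h) * pathTerm q (suc h) τ c))
  where
  drop-zeros : ∀ x y → 0ℚ + (x + (0ℚ + (y + 0ℚ))) ≡ x + y
  drop-zeros = solve-∀ ℚ-ring

pathSum≡ansatz : ∀ q {n} (τ : Config n) h → pathSum q h τ ≡ ansatz q τ h
pathSum≡ansatz q []      zero    = refl
pathSum≡ansatz q []      (suc h) = refl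
pathSum≡ansatz q {suc n} (a ∷ τ) h = begin
    pathSum q h (a ∷ τ)
  ≡⟨ sumL-concatMap (pathTerm q h (a ∷ τ)) steps (allPaths n) ⟩
    sumL (λ c → sumL (pathTerm q h (a ∷ τ)) (steps c)) (allPaths n)
  ≡⟨ sumL-cong (λ c → pathTerm-step q a τ c h) (allPaths n) ⟩
    sumL (λ c → transfer q a (λ k → pathTerm q k τ c) h) (allPaths n)
  ≡⟨ transfer-sumL q a (λ c k → pathTerm q k τ c) (allPaths n) h ⟩
    transfer q a (λ k → pathSum q k τ) h
  ≡⟨ transfer-cong q a (pathSum≡ansatz q τ) h ⟩
    ansatz q (a ∷ τ) h
  ∎
  where
  steps : Vec Step n → List (Vec Step (suc n))
  steps c = (N ∷ c) ∷ (S ∷ c) ∷ (E ∷ c) ∷ (Ē ∷ c) ∷ []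

F'''≡ansatz : ∀ q {n} (τ : Config n) → F''' q τ ≡ ansatz q τ 0
F'''≡ansatz q τ = pathSum≡ansatz q τ 0

qint-nonneg : ∀ {q} → 0ℚ ≤ q → ∀ m → 0ℚ ≤ qint q m
qint-nonneg 0≤q zero    = QP.≤-refl
qint-nonneg 0≤q (suc m) = QP.+-mono-≤ 0≤1 (0≤* 0≤q (qint-nonneg 0≤q m))

jumpWeight-nonneg : ∀ {q} → 0ℚ ≤ q → ∀ a h → 0ℚ ≤ jumpWeight q a h
jumpWeight-nonneg 0≤q true  h = qint-nonneg 0≤q (suc (suc h))
jumpWeight-nonneg 0≤q false h = qint-nonneg 0≤q h

ansatz-nonneg : ∀ {q} → 0ℚ ≤ q → ∀ {n} (τ : Config n) h → 0ℚ ≤ ansatz q τ h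
ansatz-nonneg 0≤q []      zero    = 0≤1
ansatz-nonneg 0≤q []      (suc h) = QP.≤-refl
ansatz-nonneg 0≤q (a ∷ τ) h =
  QP.+-mono-≤ (0≤* (jumpWeight-nonneg 0≤q a h) (ansatz-nonneg 0≤q τ (jump a h)))
              (0≤* (qint-nonneg 0≤q (suc h)) (ansatz-nonneg 0≤q τ h))

ansatz-≥1 : ∀ {q} → 0ℚ ≤ q → ∀ {n} (τ : Config n) → 1ℚ ≤ ansatz q τ 0
ansatz-≥1     0≤q []      = QP.≤-refl
ansatz-≥1 {q} 0≤q (a ∷ τ) =
  QP.≤-trans (ansatz-≥1 0≤q τ)
             (subst (_≤ transfer q a (ansatz q τ) 0) (one-* q (ansatz q τ 0))
                    (y≤x+y (0≤* (jumpWeight-nonneg 0≤q a 0) (ansatz-nonneg 0≤q τ (jump a 0)))))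
  where
  one-* : ∀ q x → (1ℚ + q * 0ℚ) * x ≡ x
  one-* = solve-∀ ℚ-ring

F'''-positive : ∀ {q} → 0ℚ ≤ q → ∀ {n} (τ : Config n) → 0ℚ < F''' q τ
F'''-positive {q} 0≤q τ =
  subst (0ℚ <_) (sym (F'''≡ansatz q τ)) (QP.<-≤-trans (QP.positive⁻¹ 1ℚ) (ansatz-≥1 0≤q τ))

flux-prepend : ∀ q {n} a (L : List (Config n × ℚ)) h →
  flux (λ X → ansatz q X h) (map (prepend a) L) ≡ transfer q a (λ k → flux (λ X → ansatz q X k) L) h
flux-prepend q a L h = begin
    flux (λ X → ansatz q X h) (map (prepend a) L)
  ≡⟨ sumL-map (λ m → proj₂ m * ansatz q (proj₁ m) h) (prepend a) L ⟩
    sumL (λ m → proj₂ m * transfer q a (ansatz q (proj₁ m)) h) L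
  ≡⟨ sumL-cong (λ m → transfer-*ˡ q a (proj₂ m) (ansatz q (proj₁ m)) h) L ⟨
    sumL (λ m → transfer q a (λ k → proj₂ m * ansatz q (proj₁ m) k) h) L
  ≡⟨ transfer-sumL q a (λ m k → proj₂ m * ansatz q (proj₁ m) k) L h ⟩
    transfer q a (λ k → flux (λ X → ansatz q X k) L) h
  ∎

defect : ∀ {n} (f : Config n → ℚ) (ins outs : List (Config n × ℚ)) (Y : Config n) → ℚ
defect f ins outs Y = flux f ins - f Y * totalRate outs

hat : Bool → ℚ
hat true  = - 1ℚ
hat false = 1ℚ

swap-defect : ∀ q {n} a b (X : Config n) h →
  defect (λ Y → ansatz q Y h) (swapIn q a b X) (swapOut q a b X) (a ∷ b ∷ X) ≡
  hat a * ansatz q (b ∷ X) h - hat b * ansatz q (a ∷ X) h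
swap-defect q true false X h =
  trans (cong (λ w → q * ED + 0ℚ - w * (1ℚ + 0ℚ)) (transfer-DE-relation q (ansatz q X) h))
        (cancel q ED (ansatz q (true ∷ X) h) (ansatz q (false ∷ X) h))
  where
  ED = ansatz q (false ∷ true ∷ X) h
  cancel : ∀ q w d e → q * w + 0ℚ - (q * w + d + e) * (1ℚ + 0ℚ) ≡ - 1ℚ * e - 1ℚ * d
  cancel = solve-∀ ℚ-ring
swap-defect q false true X h =
  trans (cong (λ w → 1ℚ * w + 0ℚ - ED * (q + 0ℚ)) (transfer-DE-relation q (ansatz q X) h))
        (cancel q ED (ansatz q (true ∷ X) h) (ansatz q (false ∷ X) h))
  where
  ED = ansatz q (false ∷ true ∷ X) h
  cancel : ∀ q w d e → 1ℚ * (q * w + d + e) + 0ℚ - w * (q + 0ℚ) ≡ 1ℚ * d - - 1ℚ * e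
  cancel = solve-∀ ℚ-ring
swap-defect q true true X h = cancel (ansatz q (true ∷ true ∷ X) h) (hat true * ansatz q (true ∷ X) h)
  where
  cancel : ∀ w x → 0ℚ - w * 0ℚ ≡ x - x
  cancel = solve-∀ ℚ-ring
swap-defect q false false X h = cancel (ansatz q (false ∷ false ∷ X) h) (hat false * ansatz q (false ∷ X) h)
  where
  cancel : ∀ w x → 0ℚ - w * 0ℚ ≡ x - x
  cancel = solve-∀ ℚ-ring

right-defect : ∀ q {n} a (X : Config n) h →
  defect (λ Y → ansatz q Y h) (rightIn 1ℚ q (a ∷ X)) (rightOut 1ℚ q (a ∷ X)) (a ∷ X) ≡
  hat a * ansatz q X h
right-defect q true [] h =
  trans (cong (λ w → 0ℚ - w * (1ℚ + 0ℚ)) (transfer-true-vacuum q h)) (cancel (vacuum h))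
  where
  cancel : ∀ v → 0ℚ - v * (1ℚ + 0ℚ) ≡ - 1ℚ * v
  cancel = solve-∀ ℚ-ring
right-defect q false [] h =
  trans (cong (λ w → 1ℚ * w + 0ℚ - ansatz q (false ∷ []) h * 0ℚ) (transfer-true-vacuum q h))
        (cancel (vacuum h) (ansatz q (false ∷ []) h))
  where
  cancel : ∀ v w → 1ℚ * v + 0ℚ - w * 0ℚ ≡ 1ℚ * v
  cancel = solve-∀ ℚ-ring
right-defect q a (b ∷ X) h = begin
    defect (G h) (swapIn q a b X ++ map (prepend a) R) (rightOut 1ℚ q (a ∷ b ∷ X)) (a ∷ b ∷ X)
  ≡⟨ cong₂ (λ i o → i - G h (a ∷ b ∷ X) * o) split-in split-out ⟩
    (swapFlux + tailFlux) - G h (a ∷ b ∷ X) * (swapRate + tailRate)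
  ≡⟨ regroup swapFlux tailFlux (G h (a ∷ b ∷ X)) swapRate tailRate ⟩
    (swapFlux - G h (a ∷ b ∷ X) * swapRate) + (tailFlux - transfer q a (ansatz q (b ∷ X)) h * tailRate)
  ≡⟨ cong₂ _+_ (swap-defect q a b X h)
               (transfer-affine q a (λ k → flux (G k) R) (ansatz q (b ∷ X)) tailRate h) ⟩
    local + transfer q a (λ k → defect (G k) R (rightOut 1ℚ q (b ∷ X)) (b ∷ X)) h
  ≡⟨ cong (local +_) (transfer-cong q a (right-defect q b X) h) ⟩
    local + transfer q a (λ k → hat b * ansatz q X k) h
  ≡⟨ cong (local +_) (transfer-*ˡ q a (hat b) (ansatz q X) h) ⟩
    (hat a * G h (b ∷ X) - hat b * G h (a ∷ X)) + hat b * G h (a ∷ X)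
  ≡⟨ cancel (hat a * G h (b ∷ X)) (hat b * G h (a ∷ X)) ⟩
    hat a * G h (b ∷ X)
  ∎
  where
  G : ℕ → ∀ {m} → Config m → ℚ
  G h Y = ansatz q Y h
  R        = rightIn 1ℚ q (b ∷ X)
  swapFlux = flux (G h) (swapIn q a b X)
  swapRate = totalRate (swapOut q a b X)
  tailFlux = transfer q a (λ k → flux (G k) R) h
  tailRate = totalRate (rightOut 1ℚ q (b ∷ X))
  local    = hat a * G h (b ∷ X) - hat b * G h (a ∷ X)
  split-in : flux (G h) (swapIn q a b X ++ map (prepend a) R) ≡ swapFlux + tailFlux
  split-in = trans (flux-++ (G h) (swapIn q a b X) _) (cong (swapFlux +_) (flux-prepend q a R h))
  split-out : totalRate (rightOut 1ℚ q (a ∷ b ∷ X)) ≡ swapRate + tailRate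
  split-out = trans (cong totalRate (rightOut-cons 1ℚ q a b X))
                    (trans (totalRate-++ (swapOut q a b X) _)
                           (cong (swapRate +_) (totalRate-prepend a (rightOut 1ℚ q (b ∷ X)))))
  regroup : ∀ s t g o O → (s + t) - g * (o + O) ≡ (s - g * o) + (t - g * O)
  regroup = solve-∀ ℚ-ring
  cancel : ∀ x y → x - y + y ≡ x
  cancel = solve-∀ ℚ-ring

entry-defect : ∀ q {n} a (X : Config n) →
  defect (λ Y → ansatz q Y 0) (entryIn 1ℚ (a ∷ X)) (entryMoves 1ℚ (a ∷ X)) (a ∷ X) ≡
  - (hat a * ansatz q X 0)
entry-defect q true X =
  trans (cong (λ w → 1ℚ * w + 0ℚ - ansatz q (true ∷ X) 0 * 0ℚ) (transfer-false-top q (ansatz q X)))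
        (cancel (ansatz q X 0) (ansatz q (true ∷ X) 0))
  where
  cancel : ∀ v w → 1ℚ * v + 0ℚ - w * 0ℚ ≡ - (- 1ℚ * v)
  cancel = solve-∀ ℚ-ring
entry-defect q false X =
  trans (cong (λ w → 0ℚ - w * (1ℚ + 0ℚ)) (transfer-false-top q (ansatz q X))) (cancel (ansatz q X 0))
  where
  cancel : ∀ v → 0ℚ - v * (1ℚ + 0ℚ) ≡ - (1ℚ * v)
  cancel = solve-∀ ℚ-ring

ansatz-balanced : ∀ q {n} → FlowBalanced 1ℚ 1ℚ q {n} (λ X → ansatz q X 0)
ansatz-balanced q []      = refl
ansatz-balanced q (a ∷ X) = begin
    flux G (entryIn 1ℚ (a ∷ X) ++ rightIn 1ℚ q (a ∷ X))
  ≡⟨ flux-++ G (entryIn 1ℚ (a ∷ X)) _ ⟩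
    flux G (entryIn 1ℚ (a ∷ X)) + flux G (rightIn 1ℚ q (a ∷ X))
  ≡⟨ recombine (flux G (entryIn 1ℚ (a ∷ X))) (flux G (rightIn 1ℚ q (a ∷ X))) (G (a ∷ X))
               entryRate rightRate ⟩
    defect G (entryIn 1ℚ (a ∷ X)) (entryMoves 1ℚ (a ∷ X)) (a ∷ X)
      + defect G (rightIn 1ℚ q (a ∷ X)) (rightOut 1ℚ q (a ∷ X)) (a ∷ X)
      + G (a ∷ X) * (entryRate + rightRate)
  ≡⟨ cong₂ (λ e r → e + r + G (a ∷ X) * (entryRate + rightRate))
           (entry-defect q a X) (right-defect q a X 0) ⟩
    - (hat a * G X) + hat a * G X + G (a ∷ X) * (entryRate + rightRate)
  ≡⟨ cancel (hat a * G X) (G (a ∷ X) * (entryRate + rightRate)) ⟩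
    G (a ∷ X) * (entryRate + rightRate)
  ≡⟨ cong (G (a ∷ X) *_) (totalRate-++ (entryMoves 1ℚ (a ∷ X)) _) ⟨
    G (a ∷ X) * outRate 1ℚ 1ℚ q (a ∷ X)
  ∎
  where
  G : ∀ {m} → Config m → ℚ
  G Y = ansatz q Y 0
  entryRate = totalRate (entryMoves 1ℚ (a ∷ X))
  rightRate = totalRate (rightOut 1ℚ q (a ∷ X))
  recombine : ∀ e r g o O → e + r ≡ (e - g * o) + (r - g * O) + g * (o + O)
  recombine = solve-∀ ℚ-ring
  cancel : ∀ s t → - s + s + t ≡ t
  cancel = solve-∀ ℚ-ring

-- Irreducibility and the maximum principle

-- The moves of rate 1 when α = β = 1; by themselves they connect any two configurations.
data _⇀_ : ∀ {n} → Config n → Config n → Set where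
  hop  : ∀ {n} {X : Config n} → (true ∷ false ∷ X) ⇀ (false ∷ true ∷ X)
  exit : (true ∷ []) ⇀ (false ∷ [])
  skip : ∀ {n} {b} {X Y : Config n} → X ⇀ Y → (b ∷ X) ⇀ (b ∷ Y)

data _⟶_ : ∀ {n} → Config n → Config n → Set where
  enter : ∀ {n} {X : Config n} → (false ∷ X) ⟶ (true ∷ X)
  right : ∀ {n} {X Y : Config n} → X ⇀ Y → X ⟶ Y

⇀⇒rightIn : ∀ q {n} {X Y : Config n} → X ⇀ Y → (X , 1ℚ) ∈ rightIn 1ℚ q Y
⇀⇒rightIn q hop  = here refl
⇀⇒rightIn q exit = here refl
⇀⇒rightIn q (skip {b = b} {Y = c ∷ Y} X⇀Y) =
  ∈-++⁺ʳ (swapIn q b c Y) (∈-map⁺ (prepend b) (⇀⇒rightIn q X⇀Y))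

⟶⇒inMoves : ∀ q {n} {X Y : Config n} → X ⟶ Y → (X , 1ℚ) ∈ inMoves 1ℚ 1ℚ q Y
⟶⇒inMoves q enter                 = here refl
⟶⇒inMoves q (right {Y = Y} X⇀Y) = ∈-++⁺ʳ (entryIn 1ℚ Y) (⇀⇒rightIn q X⇀Y)

flush : ∀ n → Star _⇀_ (true ∷ empty n) (empty (suc n))
flush zero    = exit ◅ ε
flush (suc n) = hop ◅ Star.gmap (false ∷_) skip (flush n)

toEmpty : ∀ {n} (X : Config n) → Star _⇀_ X (empty n)
toEmpty []          = ε
toEmpty (false ∷ X) = Star.gmap (false ∷_) skip (toEmpty X)
toEmpty (true ∷ X)  = Star.gmap (true ∷_) skip (toEmpty X) ◅◅ flush _

behindEmpty : ∀ {n} {X Y : Config n} → X ⟶ Y → Star _⟶_ (false ∷ X) (false ∷ Y)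
behindEmpty enter       = enter ◅ right hop ◅ ε
behindEmpty (right X⇀Y) = right (skip X⇀Y) ◅ ε

fromEmpty : ∀ {n} (X : Config n) → Star _⟶_ (empty n) X
fromEmpty []          = ε
fromEmpty (false ∷ X) = Star.kleisliStar (false ∷_) behindEmpty (fromEmpty X)
fromEmpty (true ∷ X)  = Star.kleisliStar (false ∷_) behindEmpty (fromEmpty X) ◅◅ enter ◅ ε

reachable : ∀ {n} (X Y : Config n) → Star _⟶_ X Y
reachable X Y = Star.map right (toEmpty X) ◅◅ fromEmpty Y

module _ (q : ℚ) (0≤q : 0ℚ ≤ q) {n : ℕ} (F π : Config n → ℚ) (F>0 : ∀ X → 0ℚ < F X)
         (F-balanced : FlowBalanced 1ℚ 1ℚ q F) (π-balanced : FlowBalanced 1ℚ 1ℚ q π) where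

  private
    ρ : Config n → ℚ
    ρ X = π X * (1/ F X) {{Q.>-nonZero (F>0 X)}}

    π≡Fρ : ∀ X → π X ≡ F X * ρ X
    π≡Fρ X = sym (begin
        F X * (π X * 1/ F X)   ≡⟨ solve₁ (F X) (π X) (1/ F X) ⟩
        π X * (F X * 1/ F X)   ≡⟨ cong (π X *_) (QP.*-inverseʳ (F X)) ⟩
        π X * 1ℚ               ≡⟨ QP.*-identityʳ (π X) ⟩
        π X                    ∎)
      where
      instance _ = Q.>-nonZero (F>0 X)
      solve₁ : ∀ f p i → f * (p * i) ≡ p * (f * i)
      solve₁ = solve-∀ ℚ-ring

    IsMax : Config n → Set
    IsMax X = ∀ W → ρ W ≤ ρ X

    -- At a maximum X of ρ, inflow π X ≤ ρ X · inflow F X termwise with equality in total,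
    -- so every rate-1 predecessor of X attains the maximum too.
    max-backward-step : ∀ {W X} → W ⟶ X → IsMax X → IsMax W
    max-backward-step {W} {X} W⟶X X-max V = subst (ρ V ≤_) (sym ρW≡ρX) (X-max V)
      where
      L = inMoves 1ℚ 1ℚ q X
      π≤Fρ : ∀ V → π V ≤ F V * ρ X
      π≤Fρ V = subst (_≤ F V * ρ X) (sym (π≡Fρ V)) (*-monoˡ-≤-0≤ (QP.<⇒≤ (F>0 V)) (X-max V))
      dominated : All (λ m → proj₂ m * π (proj₁ m) ≤ proj₂ m * (F (proj₁ m) * ρ X)) L
      dominated = All.map (λ 0≤r → *-monoˡ-≤-0≤ 0≤r (π≤Fρ _))
                          (inMoves-nonneg 0≤1 0≤1 0≤q X)
      fluxes : flux π L ≡ flux (λ V → F V * ρ X) L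
      fluxes = begin
        flux π L                          ≡⟨ π-balanced X ⟩
        π X * outRate 1ℚ 1ℚ q X           ≡⟨ cong (_* outRate 1ℚ 1ℚ q X) (π≡Fρ X) ⟩
        F X * ρ X * outRate 1ℚ 1ℚ q X     ≡⟨ swap (F X) (ρ X) (outRate 1ℚ 1ℚ q X) ⟩
        F X * outRate 1ℚ 1ℚ q X * ρ X     ≡⟨ cong (_* ρ X) (F-balanced X) ⟨
        flux F L * ρ X                    ≡⟨ flux-*ʳ F (ρ X) L ⟨
        flux (λ V → F V * ρ X) L          ∎
        where
        swap : ∀ x y z → x * y * z ≡ x * z * y
        swap = solve-∀ ℚ-ring
      ρW≡ρX : ρ W ≡ ρ X
      ρW≡ρX = *-cancelˡ-nonZero (F W) {{Q.>-nonZero (F>0 W)}} (begin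
        F W * ρ W              ≡⟨ π≡Fρ W ⟨
        π W                    ≡⟨ QP.*-identityˡ (π W) ⟨
        1ℚ * π W               ≡⟨ sumL-≤-tight dominated fluxes (⟶⇒inMoves q W⟶X) ⟩
        1ℚ * (F W * ρ X)       ≡⟨ QP.*-identityˡ (F W * ρ X) ⟩
        F W * ρ X              ∎)

    max-backward : ∀ {W X} → Star _⟶_ W X → IsMax X → IsMax W
    max-backward ε                X-max = X-max
    max-backward (W⟶Y ◅ Y⟶⋆X) X-max = max-backward-step W⟶Y (max-backward Y⟶⋆X X-max)

    X* : Config n
    X* = argmax ρ (empty n) (allConfigs n)

    X*-max : IsMax X*
    X*-max W = All.lookup (f[xs]≤f[argmax] {f = ρ} (empty n) (allConfigs n)) (∈-allConfigs W)

  balanced⇒proportional : Σ ℚ λ c → ∀ X → π X ≡ F X * c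
  balanced⇒proportional = ρ X* , λ X →
    trans (π≡Fρ X) (cong (F X *_) (QP.≤-antisym (X*-max X) (max-backward (reachable X X*) X*-max X*)))

divQ-pos : ∀ p {r} (0<r : 0ℚ < r) → p divQ r ≡ p * (1/ r) {{Q.>-nonZero 0<r}}
divQ-pos p {r} 0<r with r Q.≟ 0ℚ
... | yes r≡0 = ⊥-elim (QP.<-irrefl (sym r≡0) 0<r)
... | no  _   = refl

balanced⇒stationary : ∀ α β q {n} (f : Config n → ℚ) → (∀ X → 0ℚ < f X) →
                      FlowBalanced α β q f →
                      IsStationary n α β q (λ X → f X divQ sumL f (allConfigs n))
balanced⇒stationary α β q {n} f f>0 f-balanced = record
  { nonneg     = λ X → subst (0ℚ ≤_) (sym (normalised≡ X)) (0≤* (QP.<⇒≤ (f>0 X)) 0≤1/Σf)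
  ; normalised = trans (sumL-cong normalised≡ (allConfigs n))
                       (trans (sumL-*ʳ (1/ Σf) f (allConfigs n)) (QP.*-inverseʳ Σf))
  ; balance    = balanced⇒invariant α β q
                   (balanced-cong α β q (λ X → sym (normalised≡ X)) (balanced-*ʳ α β q (1/ Σf) f-balanced))
  }
  where
  Σf   = sumL f (allConfigs n)
  0<Σf = sumL-positive f>0
  instance
    Σf>0 : Q.Positive Σf
    Σf>0 = Q.positive 0<Σf
    Σf≢0 : Q.NonZero Σf
    Σf≢0 = QP.pos⇒nonZero Σf
  normalised≡ : ∀ X → f X divQ Σf ≡ f X * 1/ Σf
  normalised≡ X = divQ-pos (f X) 0<Σf
  0≤1/Σf : 0ℚ ≤ 1/ Σf
  0≤1/Σf = QP.<⇒≤ (QP.positive⁻¹ (1/ Σf) {{QP.1/pos⇒pos Σf}})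

stationary-unique : ∀ q → 0ℚ ≤ q → ∀ {n} (f : Config n → ℚ) → (∀ X → 0ℚ < f X) →
                    FlowBalanced 1ℚ 1ℚ q f →
                    (π : Config n → ℚ) → IsStationary n 1ℚ 1ℚ q π →
                    ∀ X → π X ≡ f X divQ sumL f (allConfigs n)
stationary-unique q 0≤q {n} f f>0 f-balanced π π-stationary X = begin
    π X          ≡⟨ π≡fc X ⟩
    f X * c      ≡⟨ cong (f X *_) c≡1/Σf ⟩
    f X * 1/ Σf  ≡⟨ divQ-pos (f X) 0<Σf ⟨
    f X divQ Σf  ∎
  where
  open IsStationary π-stationary
  Σf   = sumL f (allConfigs n)
  0<Σf = sumL-positive f>0
  instance
    Σf≢0 : Q.NonZero Σf
    Σf≢0 = Q.>-nonZero 0<Σf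
  proportional = balanced⇒proportional q 0≤q f π f>0 f-balanced (invariant⇒balanced 1ℚ 1ℚ q balance)
  c    = proj₁ proportional
  π≡fc = proj₂ proportional
  c≡1/Σf : c ≡ 1/ Σf
  c≡1/Σf = *-cancelˡ-nonZero Σf (begin
    Σf * c                              ≡⟨ sumL-*ʳ c f (allConfigs n) ⟨
    sumL (λ X → f X * c) (allConfigs n) ≡⟨ sumL-cong (λ X → sym (π≡fc X)) (allConfigs n) ⟩
    sumL π (allConfigs n)               ≡⟨ normalised ⟩
    1ℚ                                  ≡⟨ QP.*-inverseʳ Σf ⟨
    Σf * 1/ Σf                          ∎)

corollary6p2 : (n : ℕ) → n ≥ 1 → (q : ℚ) → 0ℚ ≤ q → q ≤ 1ℚ →
    IsStationary n 1ℚ 1ℚ q (λ τ → F''' q τ divQ Z q n)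
    × ((π : Config n → ℚ) → IsStationary n 1ℚ 1ℚ q π →
       (τ : Config n) → π τ ≡ F''' q τ divQ Z q n)
corollary6p2 n _ q 0≤q _ =
    balanced⇒stationary 1ℚ 1ℚ q (F''' q) (F'''-positive 0≤q) F'''-balanced
  , stationary-unique q 0≤q (F''' q) (F'''-positive 0≤q) F'''-balanced
  where
  F'''-balanced : FlowBalanced 1ℚ 1ℚ q (F''' q)
  F'''-balanced = balanced-cong 1ℚ 1ℚ q (λ τ → sym (F'''≡ansatz q τ)) (ansatz-balanced q)
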